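{- Let $M_2$ be the Turing machine with states $A,B$ (plus the halting state $H$), symbols $0,1,2,3$ ($0$ blank) and transition table $\delta(A,0)=(1,R,B)$, $\delta(A,1)=(2,L,A)$, $\delta(A,2)=(1,R,A)$, $\delta(A,3)=(1,R,A)$; $\delta(B,0)=(1,L,B)$, $\delta(B,1)=(1,L,A)$, $\delta(B,2)=(3,R,B)$, $\delta(B,3)=(1,R,H)$. For $n \ge 0$ let $C(n,1) = {}^\omega 0\,(A0)\,2^n\,1\,0^\omega$ and $C(n,2) = {}^\omega 0\,(A0)\,2^n\,1\,1\,0^\omega$. Then (a) ${}^\omega 0(A0)0^\omega \vdash(6)\ C(1,2)$, and, for all integers $k\ge 0$: (b) $C(3k,1) \vdash(15k^2+9k+3)\ C(5k+1,1)$; (c) $C(3k+1,1) \vdash(15k^2+24k+13)\ {}^\omega 0\,1\,3^{5k+2}\,1\,(H1)\,0^\omega$; (d) $C(3k+2,1) \vdash(15k^2+29k+17)\ C(5k+4,2)$; (e) $C(3k,2) \vdash(15k^2+11k+3)\ C(5k+1,2)$; (f) $C(3k+1,2) \vdash(15k^2+21k+7)\ C(5k+3,1)$; (g) $C(3k+2,2) \vdash(15k^2+36k+23)\ {}^\omega 0\,1\,3^{5k+4}\,1\,(H1)\,0^\omega$.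
   Context: Turing machines here have one tape, infinite in both directions. $\delta(q,a)=(b,D,q')$ means: in state $q$ reading symbol $a$, the machine writes $b$ on the current cell, moves the head one cell left ($D=L$) or right ($D=R$), and enters state $q'$. When the machine enters the halting state $H$ it stops. A configuration is written ${}^\omega 0\, x\,(S a)\, y\, 0^\omega$, where $x,y$ are finite words: the tape contains the word $xay$ surrounded on both sides by infinitely many $0$'s, the machine is in state $S$, and the head scans the cell containing the displayed symbol $a$. Each digit is one tape symbol; $w^n$ denotes the concatenation of $n$ copies of $w$ (an exponent applies to the single preceding symbol unless parentheses are used), $w^0$ is empty. $C_1 \vdash(t)\ C_2$ means that the machine, started in configuration $C_1$, is in configuration $C_2$ after exactly $t$ steps. -}

module Defs where

open import Data.Nat using (ℕ; zero; suc)
open import Data.List using (List; []; _∷_; reverse; replicate; _++_)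
open import Data.Maybe using (Maybe; just; nothing)
open import Data.Product using (Σ; _×_; _,_)
open import Relation.Binary.PropositionalEquality using (_≡_)

data Sym : Set where
  s0 s1 s2 s3 : Sym

data State : Set where
  A B H : State

data Dir : Set where
  L R : Dir

Table : Set
Table = State → Sym → Maybe (Sym × Dir × State)

δ₂ : Table
δ₂ A s0 = just (s1 , R , B)
δ₂ A s1 = just (s2 , L , A)
δ₂ A s2 = just (s1 , R , A)
δ₂ A s3 = just (s1 , R , A)
δ₂ B s0 = just (s1 , L , B)
δ₂ B s1 = just (s1 , L , A)
δ₂ B s2 = just (s3 , R , B)
δ₂ B s3 = just (s1 , R , H)
δ₂ H _  = nothing

-- A configuration, relative to the head: the cells to the left of the head
-- (index 0 = adjacent cell, going leftwards), the scanned symbol, and the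
-- cells to the right (index 0 = adjacent cell, going rightwards).
record Config : Set where
  constructor ⟨_∣_∣_∣_⟩
  field
    state : State
    left  : ℕ → Sym
    head  : Sym
    right : ℕ → Sym
open Config public

_≈_ : Config → Config → Set
c ≈ d = (state c ≡ state d) × ((∀ i → left c i ≡ left d i)
        × ((head c ≡ head d) × (∀ i → right c i ≡ right d i)))

step : Table → Config → Maybe Config
step δ ⟨ q ∣ l ∣ a ∣ r ⟩ with δ q a
... | nothing = nothing
... | just (b , L , q') = just ⟨ q' ∣ (λ i → l (suc i)) ∣ l 0 ∣ (λ { zero → b ; (suc i) → r i }) ⟩
... | just (b , R , q') = just ⟨ q' ∣ (λ { zero → b ; (suc i) → l i }) ∣ r 0 ∣ (λ i → r (suc i)) ⟩

run : Table → ℕ → Config → Maybe Config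
run δ zero c = just c
run δ (suc t) c with step δ c
... | nothing = nothing
... | just c' = run δ t c'

Yields : Table → Config → ℕ → Config → Set
Yields δ c₁ t c₂ = Σ Config (λ c → (run δ t c₁ ≡ just c) × (c ≈ c₂))

-- finite word surrounded by infinitely many blanks (reading away from head)
tape : List Sym → ℕ → Sym
tape [] _ = s0
tape (x ∷ xs) zero = x
tape (x ∷ xs) (suc i) = tape xs i

-- ^ω0 x (q a) y 0^ω, with x, y written left to right
conf : State → List Sym → Sym → List Sym → Config
conf q x a y = ⟨ q ∣ tape (reverse x) ∣ a ∣ tape y ⟩

C1 : ℕ → Config
C1 n = conf A [] s0 (replicate n s2 ++ (s1 ∷ []))

C2 : ℕ → Config
C2 n = conf A [] s0 (replicate n s2 ++ (s1 ∷ s1 ∷ []))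

Halt : ℕ → Config
Halt m = conf H (s1 ∷ replicate m s3 ++ (s1 ∷ [])) s1 []

-- From C(n,i) the machine first rewrites 2ⁿ as a counter 3ⁿ and returns to its
-- right end. It then runs in rounds, each absorbing the rightmost 3 of the counter
-- into the word 2ᵃ t to its right by a sweep right and back:
-- 3 2ᵃ 11 ↦ 2ᵃ⁺² 1 and 3 2ᵃ 1 ↦ 2ᵃ⁺² in 2a + 3 steps, 3 2ᵃ ↦ 2ᵃ⁺¹ 11 in 2a + 5 steps.
-- Three rounds restore the tail and map (3 + m, a) to (m, 5 + a) in 6a + O(1) steps,
-- so k such cycles cost 15k² + O(k). When the counter runs out, n mod 3 and the tail
-- decide whether the machine restarts from some C(n',i') or halts.

module Submission where

open import Defs
open import Data.Nat using (ℕ; zero; suc; _+_; _*_)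
open import Data.Nat.Tactic.RingSolver using (solve)
open import Data.List using (List; []; _∷_; _++_; replicate; reverse)
open import Data.List.Properties using (++-identityʳ; reverse-++; unfold-reverse)
open import Data.Maybe using (Maybe; just; nothing)
open import Data.Product using (Σ; _×_; _,_)
open import Relation.Binary.PropositionalEquality
  using (_≡_; refl; sym; trans; cong; module ≡-Reasoning)

-- As in Config, both lists are read away from the head; cells beyond them are blank.
data ListConfig : Set where
  ⟪_∣_∣_∣_⟫ : State → List Sym → Sym → List Sym → ListConfig

top : List Sym → Sym
top []      = s0
top (x ∷ _) = x

pop : List Sym → List Sym
pop []       = []
pop (_ ∷ xs) = xs

⟦_⟧ : ListConfig → Config
⟦ ⟪ q ∣ l ∣ a ∣ r ⟫ ⟧ = ⟨ q ∣ tape l ∣ a ∣ tape r ⟩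

movedR movedL : State → List Sym → List Sym → ListConfig
movedR q l r = ⟪ q ∣ l ∣ top r ∣ pop r ⟫
movedL q l r = ⟪ q ∣ pop l ∣ top l ∣ r ⟫

act : Maybe (Sym × Dir × State) → List Sym → List Sym → Maybe ListConfig
act nothing             l r = nothing
act (just (b , L , q)) l r = just (movedL q l (b ∷ r))
act (just (b , R , q)) l r = just (movedR q (b ∷ l) r)

listStep : Table → ListConfig → Maybe ListConfig
listStep δ ⟪ q ∣ l ∣ a ∣ r ⟫ = act (δ q a) l r

infixr 5 _◅_ _▸_

data _⊢_⇒[_]_ (δ : Table) : ListConfig → ℕ → ListConfig → Set where
  done : ∀ {c} → δ ⊢ c ⇒[ 0 ] c
  _◅_  : ∀ {c c' t d} → listStep δ c ≡ just c' → δ ⊢ c' ⇒[ t ] d → δ ⊢ c ⇒[ suc t ] d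

_▸_ : ∀ {δ c d e s t} → δ ⊢ c ⇒[ s ] d → δ ⊢ d ⇒[ t ] e → δ ⊢ c ⇒[ s + t ] e
done     ▸ q = q
(e ◅ p) ▸ q = e ◅ (p ▸ q)

cast : ∀ {δ c c' s s' d d'} → δ ⊢ c ⇒[ s ] d → c ≡ c' → s ≡ s' → d ≡ d' → δ ⊢ c' ⇒[ s' ] d'
cast p refl refl refl = p

≈-refl : ∀ {c} → c ≈ c
≈-refl = refl , (λ _ → refl) , refl , (λ _ → refl)

≈-trans : ∀ {c d e} → c ≈ d → d ≈ e → c ≈ e
≈-trans (q , l , a , r) (q' , l' , a' , r') =
  trans q q' , (λ i → trans (l i) (l' i)) , trans a a' , (λ i → trans (r i) (r' i))

tape-top : ∀ l → tape l 0 ≡ top l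
tape-top []      = refl
tape-top (_ ∷ _) = refl

tape-pop : ∀ l i → tape l (suc i) ≡ tape (pop l) i
tape-pop []      _ = refl
tape-pop (_ ∷ _) _ = refl

step-simulation : ∀ δ X c {c'} → X ≈ ⟦ c ⟧ → listStep δ c ≡ just c' →
  Σ Config λ X' → (step δ X ≡ just X') × (X' ≈ ⟦ c' ⟧)
step-simulation δ ⟨ q ∣ l ∣ a ∣ r ⟩ ⟪ .q ∣ l₀ ∣ .a ∣ r₀ ⟫ (refl , l≈ , refl , r≈) eq
  with δ q a | eq
... | just (b , L , q') | refl =
  _ , refl , refl , (λ i → trans (l≈ (suc i)) (tape-pop l₀ i)) , trans (l≈ 0) (tape-top l₀) ,
  λ { zero → refl ; (suc i) → r≈ i }
... | just (b , R , q') | refl =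
  _ , refl , refl , (λ { zero → refl ; (suc i) → l≈ i }) , trans (r≈ 0) (tape-top r₀) ,
  λ i → trans (r≈ (suc i)) (tape-pop r₀ i)

run-simulation : ∀ {δ X c t d} → X ≈ ⟦ c ⟧ → δ ⊢ c ⇒[ t ] d → Yields δ X t ⟦ d ⟧
run-simulation X≈c done = _ , refl , X≈c
run-simulation {δ} {X} {c} X≈c (e ◅ p) with step-simulation δ X c X≈c e
... | X' , eq , X'≈c' rewrite eq = run-simulation X'≈c' p

yields : ∀ {δ c t d e} → δ ⊢ c ⇒[ t ] d → ⟦ d ⟧ ≈ e → Yields δ ⟦ c ⟧ t e
yields p d≈e with run-simulation ≈-refl p
... | X , ran , X≈d = X , ran , ≈-trans X≈d d≈e

replicate-++-∷ : ∀ {X : Set} n (x : X) l → replicate n x ++ x ∷ l ≡ x ∷ replicate n x ++ l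
replicate-++-∷ zero    x l = refl
replicate-++-∷ (suc n) x l = cong (x ∷_) (replicate-++-∷ n x l)

reverse-replicate : ∀ {X : Set} n (x : X) → reverse (replicate n x) ≡ replicate n x
reverse-replicate zero    x = refl
reverse-replicate (suc n) x = begin
  reverse (x ∷ replicate n x)       ≡⟨ unfold-reverse x (replicate n x) ⟩
  reverse (replicate n x) ++ x ∷ [] ≡⟨ cong (_++ x ∷ []) (reverse-replicate n x) ⟩
  replicate n x ++ x ∷ []           ≡⟨ replicate-++-∷ n x [] ⟩
  x ∷ replicate n x ++ []           ≡⟨ cong (x ∷_) (++-identityʳ (replicate n x)) ⟩
  x ∷ replicate n x                 ∎
  where open ≡-Reasoning

sweepR : ∀ δ {q a b} → δ q a ≡ just (b , R , q) →
  ∀ n l r → δ ⊢ movedR q l (replicate n a ++ r) ⇒[ n ] movedR q (replicate n b ++ l) r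
sweepR δ loop zero    l r = done
sweepR δ {q} {b = b} loop (suc n) l r =
  cong (λ m → act m l _) loop ◅
  cast (sweepR δ loop n (b ∷ l) r) refl refl (cong (λ l' → movedR q l' r) (replicate-++-∷ n b l))

sweepL : ∀ δ {q a b} → δ q a ≡ just (b , L , q) →
  ∀ n l r → δ ⊢ movedL q (replicate n a ++ l) r ⇒[ n ] movedL q l (replicate n b ++ r)
sweepL δ loop zero    l r = done
sweepL δ {q} {b = b} loop (suc n) l r =
  cong (λ m → act m _ r) loop ◅
  cast (sweepL δ loop n l (b ∷ r)) refl refl (cong (movedL q l) (replicate-++-∷ n b r))

_⇒[_]_ : ListConfig → ℕ → ListConfig → Set
c ⇒[ t ] d = δ₂ ⊢ c ⇒[ t ] d

C : ℕ → List Sym → ListConfig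
C n t = ⟪ A ∣ [] ∣ s0 ∣ replicate n s2 ++ t ⟫

-- ^ω0 1 3ᵐ (A3) 2ᵃ t 0^ω
phase : ℕ → ℕ → List Sym → ListConfig
phase m a t = ⟪ A ∣ replicate m s3 ++ s1 ∷ [] ∣ s3 ∣ replicate a s2 ++ t ⟫

halted : ℕ → ListConfig
halted m = ⟪ H ∣ s1 ∷ replicate m s3 ++ s1 ∷ [] ∣ s1 ∣ [] ⟫

round : ∀ {t t' b} → (∀ l → movedR A l t ⇒[ b ] movedL A l t') →
  ∀ l a → ⟪ A ∣ l ∣ s3 ∣ replicate a s2 ++ t ⟫
          ⇒[ suc (a + (b + suc a)) ] movedL A l (replicate (suc a) s2 ++ t')
round {t} {t'} bounce l a =
  refl ◅ sweepR δ₂ refl a (s1 ∷ l) t ▸ bounce (replicate a s1 ++ s1 ∷ l) ▸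
  cast (sweepL δ₂ refl (suc a) l t') (cong (λ l' → movedL A l' t') (sym (replicate-++-∷ a s1 l))) refl refl

round-1 : ∀ t l a → ⟪ A ∣ l ∣ s3 ∣ replicate a s2 ++ s1 ∷ t ⟫
                     ⇒[ 2 * a + 3 ] movedL A l (replicate (2 + a) s2 ++ t)
round-1 t l a =
  cast (round (λ _ → refl ◅ done) l a) refl (solve (a ∷ [])) (cong (movedL A l) (replicate-++-∷ (suc a) s2 t))

round-0 : ∀ l a → ⟪ A ∣ l ∣ s3 ∣ replicate a s2 ++ [] ⟫
                   ⇒[ 2 * a + 5 ] movedL A l (replicate (1 + a) s2 ++ s1 ∷ s1 ∷ [])
round-0 l a = cast (round (λ _ → refl ◅ refl ◅ refl ◅ done) l a) refl (solve (a ∷ [])) refl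

Cycle : List Sym → ℕ → Set
Cycle t d = ∀ m a → phase (3 + m) a t ⇒[ 6 * a + 15 + d ] phase m (5 + a) t

cycle-11 : Cycle (s1 ∷ s1 ∷ []) 8
cycle-11 m a =
  cast (round-1 (s1 ∷ []) _ a ▸ round-1 [] _ (2 + a) ▸ round-0 _ (4 + a)) refl (solve (a ∷ [])) refl

cycle-1 : Cycle (s1 ∷ []) 6
cycle-1 m a =
  cast (round-1 [] _ a ▸ round-0 _ (2 + a) ▸ round-1 (s1 ∷ []) _ (3 + a)) refl (solve (a ∷ [])) refl

cycles : ∀ {t d} → Cycle t d →
  ∀ j m a → phase (3 * j + m) a t ⇒[ 15 * j * j + j * (6 * a + d) ] phase m (5 * j + a) t
cycles cyc zero    m a = done
cycles {t} {d} cyc (suc j) m a =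
  cast (cyc (3 * j + m) a ▸ cycles cyc j m (5 + a))
    (cong (λ n → phase n a t) counter)
    (solve (j ∷ a ∷ d ∷ []))
    (cong (λ n → phase m n t) (solve (j ∷ a ∷ [])))
  where
  counter : 3 + (3 * j + m) ≡ 3 * suc j + m
  counter = solve (j ∷ m ∷ [])

launch : ∀ n t → C n t ⇒[ suc n ] movedR B (replicate n s3 ++ s1 ∷ []) t
launch n t = refl ◅ sweepR δ₂ refl n (s1 ∷ []) t

enter : ∀ m t → C (suc m) (s1 ∷ t) ⇒[ m + 3 ] phase m 0 (s1 ∷ t)
enter m t = cast (launch (suc m) (s1 ∷ t) ▸ refl ◅ done) refl (solve (m ∷ [])) refl

halt : ∀ m → C (suc m) [] ⇒[ m + 4 ] halted m
halt m = cast (launch (suc m) [] ▸ refl ◅ refl ◅ done) refl (solve (m ∷ [])) refl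

exit : ∀ w → movedL A (s1 ∷ []) w ⇒[ 1 ] ⟪ A ∣ [] ∣ s0 ∣ s2 ∷ w ⟫
exit w = refl ◅ done

reverse-halted : ∀ m → reverse (s1 ∷ replicate m s3 ++ s1 ∷ []) ≡ s1 ∷ replicate m s3 ++ s1 ∷ []
reverse-halted m = begin
  reverse (s1 ∷ replicate m s3 ++ s1 ∷ [])
    ≡⟨ unfold-reverse s1 (replicate m s3 ++ s1 ∷ []) ⟩
  reverse (replicate m s3 ++ s1 ∷ []) ++ s1 ∷ []
    ≡⟨ cong (_++ s1 ∷ []) (reverse-++ (replicate m s3) (s1 ∷ [])) ⟩
  s1 ∷ reverse (replicate m s3) ++ s1 ∷ []
    ≡⟨ cong (λ w → s1 ∷ w ++ s1 ∷ []) (reverse-replicate m s3) ⟩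
  s1 ∷ replicate m s3 ++ s1 ∷ [] ∎
  where open ≡-Reasoning

halted≈Halt : ∀ m → ⟦ halted m ⟧ ≈ Halt m
halted≈Halt m = refl , (λ i → cong (λ w → tape w i) (sym (reverse-halted m))) , refl , (λ _ → refl)

from-blank : C 0 [] ⇒[ 6 ] C 1 (s1 ∷ s1 ∷ [])
from-blank = refl ◅ refl ◅ refl ◅ refl ◅ refl ◅ refl ◅ done

from-C₁-3k : ∀ k → C (3 * k) (s1 ∷ [])
                   ⇒[ 15 * k * k + 9 * k + 3 ] C (5 * k + 1) (s1 ∷ [])
from-C₁-3k zero    = refl ◅ refl ◅ refl ◅ done
from-C₁-3k (suc j) =
  cast (enter (3 * j + 2) []
        ▸ cycles cycle-1 j 2 0
        ▸ round-1 [] _ (5 * j + 0)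
        ▸ round-0 _ (2 + (5 * j + 0))
        ▸ round-1 (s1 ∷ []) _ (3 + (5 * j + 0))
        ▸ exit _)
    (cong (λ n → C n (s1 ∷ [])) source) (solve (j ∷ [])) (cong (λ n → C n (s1 ∷ [])) target)
  where
  source : suc (3 * j + 2) ≡ 3 * suc j
  source = solve (j ∷ [])
  target : 6 + (5 * j + 0) ≡ 5 * suc j + 1
  target = solve (j ∷ [])

from-C₁-3k+1 : ∀ k → C (3 * k + 1) (s1 ∷ [])
                     ⇒[ 15 * k * k + 24 * k + 13 ] halted (5 * k + 2)
from-C₁-3k+1 k =
  cast (enter (3 * k + 0) []
        ▸ cycles cycle-1 k 0 0
        ▸ round-1 [] _ (5 * k + 0)
        ▸ exit _
        ▸ halt (2 + (5 * k + 0)))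
    (cong (λ n → C n (s1 ∷ [])) source) (solve (k ∷ [])) (cong halted target)
  where
  source : suc (3 * k + 0) ≡ 3 * k + 1
  source = solve (k ∷ [])
  target : 2 + (5 * k + 0) ≡ 5 * k + 2
  target = solve (k ∷ [])

from-C₁-3k+2 : ∀ k → C (3 * k + 2) (s1 ∷ [])
                     ⇒[ 15 * k * k + 29 * k + 17 ] C (5 * k + 4) (s1 ∷ s1 ∷ [])
from-C₁-3k+2 k =
  cast (enter (3 * k + 1) []
        ▸ cycles cycle-1 k 1 0
        ▸ round-1 [] _ (5 * k + 0)
        ▸ round-0 _ (2 + (5 * k + 0))
        ▸ exit _)
    (cong (λ n → C n (s1 ∷ [])) source) (solve (k ∷ [])) (cong (λ n → C n (s1 ∷ s1 ∷ [])) target)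
  where
  source : suc (3 * k + 1) ≡ 3 * k + 2
  source = solve (k ∷ [])
  target : 4 + (5 * k + 0) ≡ 5 * k + 4
  target = solve (k ∷ [])

from-C₂-3k : ∀ k → C (3 * k) (s1 ∷ s1 ∷ [])
                   ⇒[ 15 * k * k + 11 * k + 3 ] C (5 * k + 1) (s1 ∷ s1 ∷ [])
from-C₂-3k zero    = refl ◅ refl ◅ refl ◅ done
from-C₂-3k (suc j) =
  cast (enter (3 * j + 2) (s1 ∷ [])
        ▸ cycles cycle-11 j 2 0
        ▸ round-1 (s1 ∷ []) _ (5 * j + 0)
        ▸ round-1 [] _ (2 + (5 * j + 0))
        ▸ round-0 _ (4 + (5 * j + 0))
        ▸ exit _)
    (cong (λ n → C n (s1 ∷ s1 ∷ [])) source) (solve (j ∷ [])) (cong (λ n → C n (s1 ∷ s1 ∷ [])) target)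
  where
  source : suc (3 * j + 2) ≡ 3 * suc j
  source = solve (j ∷ [])
  target : 6 + (5 * j + 0) ≡ 5 * suc j + 1
  target = solve (j ∷ [])

from-C₂-3k+1 : ∀ k → C (3 * k + 1) (s1 ∷ s1 ∷ [])
                     ⇒[ 15 * k * k + 21 * k + 7 ] C (5 * k + 3) (s1 ∷ [])
from-C₂-3k+1 k =
  cast (enter (3 * k + 0) (s1 ∷ [])
        ▸ cycles cycle-11 k 0 0
        ▸ round-1 (s1 ∷ []) _ (5 * k + 0)
        ▸ exit _)
    (cong (λ n → C n (s1 ∷ s1 ∷ [])) source) (solve (k ∷ [])) (cong (λ n → C n (s1 ∷ [])) target)
  where
  source : suc (3 * k + 0) ≡ 3 * k + 1
  source = solve (k ∷ [])
  target : 3 + (5 * k + 0) ≡ 5 * k + 3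
  target = solve (k ∷ [])

from-C₂-3k+2 : ∀ k → C (3 * k + 2) (s1 ∷ s1 ∷ [])
                     ⇒[ 15 * k * k + 36 * k + 23 ] halted (5 * k + 4)
from-C₂-3k+2 k =
  cast (enter (3 * k + 1) (s1 ∷ [])
        ▸ cycles cycle-11 k 1 0
        ▸ round-1 (s1 ∷ []) _ (5 * k + 0)
        ▸ round-1 [] _ (2 + (5 * k + 0))
        ▸ exit _
        ▸ halt (4 + (5 * k + 0)))
    (cong (λ n → C n (s1 ∷ s1 ∷ [])) source) (solve (k ∷ [])) (cong halted target)
  where
  source : suc (3 * k + 1) ≡ 3 * k + 2
  source = solve (k ∷ [])
  target : 4 + (5 * k + 0) ≡ 5 * k + 4
  target = solve (k ∷ [])

theorem4p1 : Yields δ₂ (conf A [] s0 []) 6 (C2 1)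
    × ((k : ℕ)
    → Yields δ₂ (C1 (3 * k)) (15 * k * k + 9 * k + 3) (C1 (5 * k + 1))
    × Yields δ₂ (C1 (3 * k + 1)) (15 * k * k + 24 * k + 13) (Halt (5 * k + 2))
    × Yields δ₂ (C1 (3 * k + 2)) (15 * k * k + 29 * k + 17) (C2 (5 * k + 4))
    × Yields δ₂ (C2 (3 * k)) (15 * k * k + 11 * k + 3) (C2 (5 * k + 1))
    × Yields δ₂ (C2 (3 * k + 1)) (15 * k * k + 21 * k + 7) (C1 (5 * k + 3))
    × Yields δ₂ (C2 (3 * k + 2)) (15 * k * k + 36 * k + 23) (Halt (5 * k + 4)))
theorem4p1 = yields from-blank ≈-refl , λ k →
    yields (from-C₁-3k k) ≈-refl
  , yields (from-C₁-3k+1 k) (halted≈Halt (5 * k + 2))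
  , yields (from-C₁-3k+2 k) ≈-refl
  , yields (from-C₂-3k k) ≈-refl
  , yields (from-C₂-3k+1 k) ≈-refl
  , yields (from-C₂-3k+2 k) (halted≈Halt (5 * k + 4))
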